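{- Let $D$ be a bicolored directed cycle with a chord which has a bikernel, and let $C$ be its base cycle. Then $C$ contains no monochromatic directed path $(x,y,z,w)$ on four vertices.
   Context: A bicolored directed cycle with a chord is a digraph $D$ consisting of a directed cycle $C$ (the base cycle) together with one additional arc (the chord) joining two non-consecutive vertices of $C$, with every arc colored $1$ or $2$. A path is monochromatic if all its arcs have the same color. A non-empty $B\subseteq V(D)$ is a bikernel (by monochromatic paths) if: (i) for all distinct $u,v\in B$ there is no monochromatic directed $uv$-path; (ii) for every $v\in V(D)\setminus B$ there is a directed path of color $1$ from $v$ to a vertex of $B$; (iii) for every $v\in V(D)\setminus B$ there is a directed path of color $2$ from a vertex of $B$ to $v$. -}

module Defs where

open import Data.Nat using (ℕ; zero; suc; _≤_; NonZero)
open import Data.Nat.DivMod using (_%_; m%n<n)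
open import Data.Fin using (Fin; toℕ; fromℕ<)
open import Data.Fin.Subset using (Subset; _∈_; _∉_; Nonempty)
open import Data.List using (List; []; _∷_)
open import Data.List.Relation.Unary.Unique.Propositional using (Unique)
open import Data.Product using (Σ; _×_; ∃)
open import Relation.Binary.PropositionalEquality using (_≡_; _≢_)
open import Relation.Nullary using (¬_)

data Colour : Set where
  c1 c2 : Colour

next : ∀ {n} → Fin n → Fin n
next {suc m} i = fromℕ< (m%n<n (suc (toℕ i)) (suc m))

-- Base cycle arcs: i → next i, coloured cycCol i.
-- Chord: tail → head, coloured chordCol, joining two non-consecutive
-- (distinct, not adjacent along C in either direction) vertices.
record BicolouredChordedCycle (n : ℕ) : Set where
  field
    cycle≥3   : 3 ≤ n
    cycCol    : Fin n → Colour
    tail head : Fin n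
    chordCol  : Colour
    tail≢head : tail ≢ head
    head≢next : head ≢ next tail
    tail≢next : tail ≢ next head

module _ {n : ℕ} (D : BicolouredChordedCycle n) where
  open BicolouredChordedCycle D

  data Arc : Colour → Fin n → Fin n → Set where
    cyc   : ∀ i → Arc (cycCol i) i (next i)
    chord : Arc chordCol tail head

  data CycArc : Colour → Fin n → Fin n → Set where
    cyc : ∀ i → CycArc (cycCol i) i (next i)

data Walk {V : Set} (R : V → V → Set) : List V → V → V → Set where
  stop : ∀ v → Walk R (v ∷ []) v v
  step : ∀ {u v w vs} → R u v → Walk R vs v w → Walk R (u ∷ vs) u w

Path : {V : Set} → (V → V → Set) → V → V → Set
Path {V} R u v = Σ (List V) λ vs → Walk R vs u v × Unique vs

MonoPath : ∀ {n} → BicolouredChordedCycle n → Colour → Fin n → Fin n → Set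
MonoPath D c = Path (Arc D c)

record IsBikernel {n : ℕ} (D : BicolouredChordedCycle n) (B : Subset n) : Set where
  field
    nonempty    : Nonempty B
    independent : ∀ u v → u ∈ B → v ∈ B → u ≢ v →
                  ∀ c → ¬ MonoPath D c u v
    absorb1     : ∀ v → v ∉ B → ∃ λ b → b ∈ B × MonoPath D c1 v b
    dominate2   : ∀ v → v ∉ B → ∃ λ b → b ∈ B × MonoPath D c2 b v

HasBikernel : ∀ {n} → BicolouredChordedCycle n → Set
HasBikernel {n} D = ∃ λ (B : Subset n) → IsBikernel D B

{-# OPTIONS --safe #-}
module Submission where

-- A vertex v outside the bikernel B is reached from B by a colour-2 path, whose last
-- arc enters v with colour 2.  The only arcs entering v are its cycle arc and
-- possibly the chord, so if the cycle arc entering v has colour 1, v is the head of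
-- the chord.  Dually, a vertex outside B whose cycle arc leaves with colour 2 is the
-- tail of the chord.  On a colour-1 path (x, y, z, w) of the base cycle, each of
-- y, z, w is therefore in B or the head; since they are pairwise joined by colour-1
-- paths, independence allows at most one of them in B, and at most one of them is
-- the head.  The colour-2 case is dual, using x, y, z and the tail.

open import Defs
open import Data.Nat using (ℕ; suc; _+_; _<_)
open import Data.Nat.Properties using (+-suc)
open import Data.Nat.DivMod using (_%_; m%n%n≡m%n; [m+n]%n≡m%n; m<n⇒m%n≡m; %-distribˡ-+)
open import Data.Fin using (Fin; toℕ)
open import Data.Fin.Properties using (toℕ-fromℕ<; toℕ-injective; toℕ<n)
open import Data.Fin.Subset using (Subset; _∈_)
open import Data.Fin.Subset.Properties using (_∈?_)
open import Data.List using ([]; _∷_)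
open import Data.List.Relation.Unary.Unique.Propositional using (Unique)
open import Data.List.Relation.Unary.All using ([]; _∷_)
open import Data.List.Relation.Unary.AllPairs using ([]; _∷_)
open import Data.Product using (Σ; _×_; ∃; _,_)
open import Data.Sum using (_⊎_; inj₁; inj₂)
open import Data.Empty using (⊥)
open import Relation.Nullary using (¬_; yes; no)
open import Relation.Binary.PropositionalEquality
  using (_≡_; _≢_; refl; sym; trans; cong; module ≡-Reasoning)

toℕ-next : ∀ {m} (i : Fin (suc m)) → toℕ (next i) ≡ suc (toℕ i) % suc m
toℕ-next i = toℕ-fromℕ< _

suc-mod-retraction : ∀ {a m} → a < suc m → (suc a % suc m + m) % suc m ≡ a
suc-mod-retraction {a} {m} a<n = begin
  (suc a % n + m) % n          ≡⟨ %-distribˡ-+ (suc a % n) m n ⟩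
  (suc a % n % n + m % n) % n  ≡⟨ cong (λ k → (k + m % n) % n) (m%n%n≡m%n (suc a) n) ⟩
  (suc a % n + m % n) % n      ≡⟨ %-distribˡ-+ (suc a) m n ⟨
  (suc a + m) % n              ≡⟨ cong (_% n) (+-suc a m) ⟨
  (a + n) % n                  ≡⟨ [m+n]%n≡m%n a n ⟩
  a % n                        ≡⟨ m<n⇒m%n≡m a<n ⟩
  a                            ∎
  where open ≡-Reasoning
        n = suc m

next-injective : ∀ {n} {i j : Fin n} → next i ≡ next j → i ≡ j
next-injective {suc m} {i} {j} eq = toℕ-injective (begin
  toℕ i                              ≡⟨ suc-mod-retraction (toℕ<n i) ⟨
  (suc (toℕ i) % suc m + m) % suc m  ≡⟨ cong (λ k → (k + m) % suc m) suc-mod-eq ⟩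
  (suc (toℕ j) % suc m + m) % suc m  ≡⟨ suc-mod-retraction (toℕ<n j) ⟩
  toℕ j                              ∎)
  where
  open ≡-Reasoning
  suc-mod-eq : suc (toℕ i) % suc m ≡ suc (toℕ j) % suc m
  suc-mod-eq = trans (sym (toℕ-next i)) (trans (cong toℕ eq) (toℕ-next j))

module _ {V : Set} {R : V → V → Set} where

  firstStep : ∀ {vs u v} → Walk R vs u v → u ≡ v ⊎ ∃ λ t → R u t
  firstStep (stop _)   = inj₁ refl
  firstStep (step r _) = inj₂ (_ , r)

  lastStep : ∀ {vs u v} → Walk R vs u v → u ≡ v ⊎ ∃ λ t → R t v
  lastStep (stop _) = inj₁ refl
  lastStep (step r rest) with lastStep rest
  ... | inj₁ refl = inj₂ (_ , r)
  ... | inj₂ last = inj₂ last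

  edgePath : ∀ {u v} → R u v → u ≢ v → Path R u v
  edgePath r u≢v = _ , step r (stop _) , (u≢v ∷ []) ∷ [] ∷ []

  twoEdgePath : ∀ {u v w} → R u v → R v w → u ≢ v → u ≢ w → v ≢ w → Path R u w
  twoEdgePath r s u≢v u≢w v≢w =
    _ , step r (step s (stop _)) , (u≢v ∷ u≢w ∷ []) ∷ (v≢w ∷ []) ∷ [] ∷ []

module _ {n : ℕ} {D : BicolouredChordedCycle n} where
  open BicolouredChordedCycle D

  cycArc⇒arc : ∀ {c u v} → CycArc D c u v → Arc D c u v
  cycArc⇒arc (cyc i) = cyc i

  arc-into : ∀ {c t v} → Arc D c t v → CycArc D c t v ⊎ v ≡ head
  arc-into (cyc i) = inj₁ (cyc i)
  arc-into chord   = inj₂ refl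

  arc-from : ∀ {c u t} → Arc D c u t → CycArc D c u t ⊎ u ≡ tail
  arc-from (cyc i) = inj₁ (cyc i)
  arc-from chord   = inj₂ refl

  cycArc-inv : ∀ {c u v} → CycArc D c u v → v ≡ next u × c ≡ cycCol u
  cycArc-inv (cyc i) = refl , refl

  cycArc-colour-into : ∀ {c c′ p t v} → CycArc D c p v → CycArc D c′ t v → c ≡ c′
  cycArc-colour-into p→v t→v with cycArc-inv p→v | cycArc-inv t→v
  ... | v≡next-p , refl | v≡next-t , refl with next-injective (trans (sym v≡next-p) v≡next-t)
  ...   | refl = refl

  cycArc-colour-from : ∀ {c c′ u v t} → CycArc D c u v → CycArc D c′ u t → c ≡ c′
  cycArc-colour-from (cyc u) (cyc u) = refl

  module Bikernel {B : Subset n} (isBikernel : IsBikernel D B) where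
    open IsBikernel isBikernel

    ∈B⊎head-after-colour1 : ∀ {p v} → CycArc D c1 p v → v ∈ B ⊎ v ≡ head
    ∈B⊎head-after-colour1 {v = v} p→v with v ∈? B
    ... | yes v∈B = inj₁ v∈B
    ... | no  v∉B with dominate2 v v∉B
    ...   | b , b∈B , _ , walk , _ with lastStep walk
    ...     | inj₁ refl = inj₁ b∈B
    ...     | inj₂ (_ , t→v) with arc-into t→v
    ...       | inj₁ cyc-t→v with () ← cycArc-colour-into p→v cyc-t→v
    ...       | inj₂ v≡head = inj₂ v≡head

    ∈B⊎tail-before-colour2 : ∀ {v q} → CycArc D c2 v q → v ∈ B ⊎ v ≡ tail
    ∈B⊎tail-before-colour2 {v} v→q with v ∈? B
    ... | yes v∈B = inj₁ v∈B
    ... | no  v∉B with absorb1 v v∉B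
    ...   | b , b∈B , _ , walk , _ with firstStep walk
    ...     | inj₁ refl = inj₁ b∈B
    ...     | inj₂ (_ , v→t) with arc-from v→t
    ...       | inj₁ cyc-v→t with () ← cycArc-colour-from v→q cyc-v→t
    ...       | inj₂ v≡tail = inj₂ v≡tail

    ¬pinnedMonoPath₃ : ∀ {c f a b d} → Arc D c a b → Arc D c b d →
                       a ≢ b → a ≢ d → b ≢ d →
                       a ∈ B ⊎ a ≡ f → b ∈ B ⊎ b ≡ f → d ∈ B ⊎ d ≡ f → ⊥
    ¬pinnedMonoPath₃ {c} a→b _ a≢b _ _ (inj₁ a∈B) (inj₁ b∈B) _ =
      independent _ _ a∈B b∈B a≢b c (edgePath a→b a≢b)
    ¬pinnedMonoPath₃ {c} a→b b→d a≢b a≢d b≢d (inj₁ a∈B) _ (inj₁ d∈B) =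
      independent _ _ a∈B d∈B a≢d c (twoEdgePath a→b b→d a≢b a≢d b≢d)
    ¬pinnedMonoPath₃ {c} _ b→d _ _ b≢d _ (inj₁ b∈B) (inj₁ d∈B) =
      independent _ _ b∈B d∈B b≢d c (edgePath b→d b≢d)
    ¬pinnedMonoPath₃ _ _ a≢b _ _ (inj₂ a≡f) (inj₂ b≡f) _ = a≢b (trans a≡f (sym b≡f))
    ¬pinnedMonoPath₃ _ _ _ a≢d _ (inj₂ a≡f) _ (inj₂ d≡f) = a≢d (trans a≡f (sym d≡f))
    ¬pinnedMonoPath₃ _ _ _ _ b≢d _ (inj₂ b≡f) (inj₂ d≡f) = b≢d (trans b≡f (sym d≡f))

mainTheorem16 : ∀ {n : ℕ} (D : BicolouredChordedCycle n) → HasBikernel D →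
    ¬ (Σ Colour λ c → Σ (Fin n) λ x → Σ (Fin n) λ y → Σ (Fin n) λ z → Σ (Fin n) λ w →
         Walk (CycArc D c) (x ∷ y ∷ z ∷ w ∷ []) x w × Unique (x ∷ y ∷ z ∷ w ∷ []))
mainTheorem16 D (_ , isBikernel)
  (c1 , _ , _ , _ , _ , step x→y (step y→z (step z→w (stop _))) ,
   (_ ∷ _ ∷ _ ∷ []) ∷ (y≢z ∷ y≢w ∷ []) ∷ (z≢w ∷ []) ∷ [] ∷ []) =
  ¬pinnedMonoPath₃ (cycArc⇒arc y→z) (cycArc⇒arc z→w) y≢z y≢w z≢w
    (∈B⊎head-after-colour1 x→y) (∈B⊎head-after-colour1 y→z) (∈B⊎head-after-colour1 z→w)
  where open Bikernel isBikernel
mainTheorem16 D (_ , isBikernel)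
  (c2 , _ , _ , _ , _ , step x→y (step y→z (step z→w (stop _))) ,
   (x≢y ∷ x≢z ∷ _ ∷ []) ∷ (y≢z ∷ _ ∷ []) ∷ _ ∷ [] ∷ []) =
  ¬pinnedMonoPath₃ (cycArc⇒arc x→y) (cycArc⇒arc y→z) x≢y x≢z y≢z
    (∈B⊎tail-before-colour2 x→y) (∈B⊎tail-before-colour2 y→z) (∈B⊎tail-before-colour2 z→w)
  where open Bikernel isBikernel
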